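{- Let $G$ be a graph and let $\{\hat C,\hat I,\hat Q\}$ be a partition of $V(G)$ (parts possibly empty) with the following properties: (1) $\hat C$ is a clique and $\hat I$ is an independent set; (2) $|\hat Q|\le 1$; (3) every vertex in $\hat Q$ is adjacent to every vertex in $\hat C$ and non-adjacent to every vertex in $\hat I$; (4) every vertex in $\hat C$ has a neighbor in $\hat I$, and every vertex in $\hat I$ has a non-neighbor in $\hat C$. Then $G$ is a split graph, and $\hat C$ is its always-clique set, $\hat I$ its always-independent set, and $\hat Q$ its questioning set.
   Context: A split graph is a graph whose vertex set can be partitioned into a clique and an independent set (parts may be empty); such an ordered pair (clique, independent set) is a split partition. For a split graph: the always-clique set is the set of vertices lying in the clique of every split partition; the always-independent set is the set of vertices lying in the independent set of every split partition; the questioning set is the set of vertices $v$ for which some split partition places $v$ in the clique and some split partition places $v$ in the independent set. -}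

module Defs where

open import Level using (0ℓ)
open import Data.Nat using (ℕ)
open import Data.Fin using (Fin)
open import Data.Bool using (Bool; true; false)
open import Data.Product using (_×_; ∃-syntax)
open import Relation.Nullary using (¬_)
open import Relation.Binary.PropositionalEquality using (_≡_; _≢_)
open import Function.Bundles using (_⇔_)

record Graph (n : ℕ) : Set₁ where
  field
    Adj   : Fin n → Fin n → Set
    sym   : ∀ {u v} → Adj u v → Adj v u
    irref : ∀ {v} → ¬ Adj v v
open Graph public

VSet : ℕ → Set₁
VSet n = Fin n → Set

IsClique : ∀ {n} → Graph n → VSet n → Set
IsClique G K = ∀ u v → K u → K v → u ≢ v → Adj G u v

IsIndependent : ∀ {n} → Graph n → VSet n → Set
IsIndependent G S = ∀ u v → S u → S v → ¬ Adj G u v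

-- A split partition (K, S) of V(G) is encoded by a labelling
-- σ : Fin n → Bool with K = σ⁻¹(true) (the clique) and S = σ⁻¹(false)
-- (the independent set); this is exactly an ordered partition into two
-- possibly empty parts.
InClique : ∀ {n} → (Fin n → Bool) → VSet n
InClique σ v = σ v ≡ true

InIndep : ∀ {n} → (Fin n → Bool) → VSet n
InIndep σ v = σ v ≡ false

IsSplitPartition : ∀ {n} → Graph n → (Fin n → Bool) → Set
IsSplitPartition G σ = IsClique G (InClique σ) × IsIndependent G (InIndep σ)

IsSplit : ∀ {n} → Graph n → Set
IsSplit G = ∃[ σ ] IsSplitPartition G σ

AlwaysClique : ∀ {n} → Graph n → VSet n
AlwaysClique G v = ∀ σ → IsSplitPartition G σ → InClique σ v

AlwaysIndependent : ∀ {n} → Graph n → VSet n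
AlwaysIndependent G v = ∀ σ → IsSplitPartition G σ → InIndep σ v

Questioning : ∀ {n} → Graph n → VSet n
Questioning G v =
  (∃[ σ ] (IsSplitPartition G σ × InClique σ v)) ×
  (∃[ σ ] (IsSplitPartition G σ × InIndep σ v))

data Part : Set where
  pC pI pQ : Part

_≐_ : ∀ {n} → VSet n → VSet n → Set
A ≐ B = ∀ v → A v ⇔ B v

{-# OPTIONS --safe #-}
-- Putting Q̂ on the clique side or on the independent side gives two split
-- partitions, so Ĉ ∪ Q̂ and Î ∪ Q̂ bound the always-clique and always-independent
-- sets from above. Conversely, a vertex c ∈ Ĉ with neighbour i ∈ Î, where i has a
-- non-neighbour c' ∈ Ĉ, is the centre of the induced path i – c – c', and such a
-- centre lies in the clique of every split partition; then i, being a non-neighbour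
-- of an always-clique vertex, lies in the independent set of every split partition.
module Submission where

open import Defs
open import Data.Fin using (Fin)
open import Data.Bool using (Bool; true; false)
open import Data.Product using (_×_; ∃-syntax; _,_; proj₁; proj₂)
open import Data.Empty using (⊥-elim)
open import Relation.Nullary using (¬_)
open import Relation.Binary.PropositionalEquality using (_≡_; _≢_; refl)
open import Function.Bundles using (mk⇔)

module _ {n} (G : Graph n) {σ : Fin n → Bool} (split : IsSplitPartition G σ) where

  neighbour-of-independent-in-clique : ∀ {u v} →
    InIndep σ u → Adj G u v → InClique σ v
  neighbour-of-independent-in-clique {u} {v} σu≡false u~v with σ v in σv
  ... | true  = refl
  ... | false = ⊥-elim (proj₂ split u v σu≡false σv u~v)

  nonneighbour-of-clique-in-independent : ∀ {u v} →
    InClique σ u → u ≢ v → ¬ Adj G u v → InIndep σ v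
  nonneighbour-of-clique-in-independent {u} {v} σu≡true u≢v u≁v with σ v in σv
  ... | true  = ⊥-elim (u≁v (proj₁ split u v σu≡true σv u≢v))
  ... | false = refl

module _ {n} (G : Graph n) where

  induced-P₃-centre-alwaysClique : ∀ {a c b} →
    Adj G a c → Adj G c b → ¬ Adj G a b → a ≢ b → AlwaysClique G c
  induced-P₃-centre-alwaysClique {a} {c} {b} a~c c~b a≁b a≢b σ split with σ c in σc
  ... | true  = refl
  ... | false = ⊥-elim (a≁b (proj₁ split a b σa σb a≢b))
    where
    σa : InClique σ a
    σa = neighbour-of-independent-in-clique G split σc (Graph.sym G a~c)
    σb : InClique σ b
    σb = neighbour-of-independent-in-clique G split σc c~b

  nonneighbour-of-alwaysClique-alwaysIndependent : ∀ {u v} →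
    AlwaysClique G u → u ≢ v → ¬ Adj G u v → AlwaysIndependent G v
  nonneighbour-of-alwaysClique-alwaysIndependent always u≢v u≁v σ split =
    nonneighbour-of-clique-in-independent G split (always σ split) u≢v u≁v

true≢false : ∀ {b} → b ≡ true → b ≢ false
true≢false refl ()

Q-to-clique : Part → Bool
Q-to-clique pC = true
Q-to-clique pI = false
Q-to-clique pQ = true

Q-to-independent : Part → Bool
Q-to-independent pC = true
Q-to-independent pI = false
Q-to-independent pQ = false

module ThreePartition {n} (G : Graph n) (p : Fin n → Part)
    (clique-C : IsClique G (λ v → p v ≡ pC))
    (independent-I : IsIndependent G (λ v → p v ≡ pI))
    (Q-subsingleton : ∀ u v → p u ≡ pQ → p v ≡ pQ → u ≡ v)
    (Q-complete-to-C : ∀ q c → p q ≡ pQ → p c ≡ pC → Adj G q c)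
    (Q-anticomplete-to-I : ∀ q i → p q ≡ pQ → p i ≡ pI → ¬ Adj G q i)
    (C-has-I-neighbour : ∀ c → p c ≡ pC → ∃[ i ] (p i ≡ pI × Adj G c i))
    (I-has-C-nonneighbour : ∀ i → p i ≡ pI → ∃[ c ] (p c ≡ pC × ¬ Adj G i c))
    where

  distinct-parts : ∀ {u v x y} → p u ≡ x → p v ≡ y → x ≢ y → u ≢ v
  distinct-parts refl pv x≢y refl = x≢y pv

  Q-in-clique-split : IsSplitPartition G (λ v → Q-to-clique (p v))
  Q-in-clique-split = clique , independent
    where
    clique : IsClique G (λ v → Q-to-clique (p v) ≡ true)
    clique u v _ _ u≢v with p u in pu | p v in pv
    ... | pC | pC = clique-C u v pu pv u≢v
    ... | pC | pQ = Graph.sym G (Q-complete-to-C v u pv pu)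
    ... | pQ | pC = Q-complete-to-C u v pu pv
    ... | pQ | pQ = ⊥-elim (u≢v (Q-subsingleton u v pu pv))
    clique u v () _ _ | pI | _
    clique u v _ () _ | pC | pI
    clique u v _ () _ | pQ | pI

    independent : IsIndependent G (λ v → Q-to-clique (p v) ≡ false)
    independent u v _ _ with p u in pu | p v in pv
    ... | pI | pI = independent-I u v pu pv
    independent u v () _ | pC | _
    independent u v () _ | pQ | _
    independent u v _ () | pI | pC
    independent u v _ () | pI | pQ

  Q-in-independent-split : IsSplitPartition G (λ v → Q-to-independent (p v))
  Q-in-independent-split = clique , independent
    where
    clique : IsClique G (λ v → Q-to-independent (p v) ≡ true)
    clique u v _ _ u≢v with p u in pu | p v in pv
    ... | pC | pC = clique-C u v pu pv u≢v
    clique u v () _ _ | pI | _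
    clique u v () _ _ | pQ | _
    clique u v _ () _ | pC | pI
    clique u v _ () _ | pC | pQ

    independent : IsIndependent G (λ v → Q-to-independent (p v) ≡ false)
    independent u v _ _ u~v with p u in pu | p v in pv
    ... | pI | pI = independent-I u v pu pv u~v
    ... | pI | pQ = Q-anticomplete-to-I v u pv pu (Graph.sym G u~v)
    ... | pQ | pI = Q-anticomplete-to-I u v pu pv u~v
    ... | pQ | pQ with Q-subsingleton u v pu pv
    ...   | refl = Graph.irref G u~v
    independent u v () _ _ | pC | _
    independent u v _ () _ | pI | pC
    independent u v _ () _ | pQ | pC

  C-alwaysClique : ∀ c → p c ≡ pC → AlwaysClique G c
  C-alwaysClique c pc with C-has-I-neighbour c pc
  ... | i , pi , c~i with I-has-C-nonneighbour i pi
  ...   | c′ , pc′ , i≁c′ =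
    induced-P₃-centre-alwaysClique G (Graph.sym G c~i) c~c′ i≁c′
      (distinct-parts pi pc′ λ ())
    where
    c≢c′ : c ≢ c′
    c≢c′ refl = i≁c′ (Graph.sym G c~i)
    c~c′ : Adj G c c′
    c~c′ = clique-C c c′ pc pc′ c≢c′

  I-alwaysIndependent : ∀ i → p i ≡ pI → AlwaysIndependent G i
  I-alwaysIndependent i pi with I-has-C-nonneighbour i pi
  ... | c , pc , i≁c =
    nonneighbour-of-alwaysClique-alwaysIndependent G (C-alwaysClique c pc)
      (distinct-parts pc pi λ ()) (λ c~i → i≁c (Graph.sym G c~i))

  alwaysClique-C : ∀ v → AlwaysClique G v → p v ≡ pC
  alwaysClique-C v always
    with p v | always _ Q-in-clique-split | always _ Q-in-independent-split
  ... | pC | _  | _  = refl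
  ... | pI | () | _
  ... | pQ | _  | ()

  alwaysIndependent-I : ∀ v → AlwaysIndependent G v → p v ≡ pI
  alwaysIndependent-I v always with p v | always _ Q-in-clique-split
  ... | pI | _  = refl
  ... | pC | ()
  ... | pQ | ()

  Q-questioning : ∀ v → p v ≡ pQ → Questioning G v
  Q-questioning v pv =
      (_ , Q-in-clique-split , Q-to-clique-true pv)
    , (_ , Q-in-independent-split , Q-to-independent-false pv)
    where
    Q-to-clique-true : ∀ {x} → x ≡ pQ → Q-to-clique x ≡ true
    Q-to-clique-true refl = refl
    Q-to-independent-false : ∀ {x} → x ≡ pQ → Q-to-independent x ≡ false
    Q-to-independent-false refl = refl

  questioning-Q : ∀ v → Questioning G v → p v ≡ pQ
  questioning-Q v ((σ , split , σv≡true) , (σ′ , split′ , σ′v≡false)) with p v in pv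
  ... | pQ = refl
  ... | pC = ⊥-elim (true≢false (C-alwaysClique v pv σ′ split′) σ′v≡false)
  ... | pI = ⊥-elim (true≢false σv≡true (I-alwaysIndependent v pv σ split))

lemma7p9 : ∀ {n} (G : Graph n) (p : Fin n → Part) →
    IsClique G (λ v → p v ≡ pC) →
    IsIndependent G (λ v → p v ≡ pI) →
    (∀ u v → p u ≡ pQ → p v ≡ pQ → u ≡ v) →
    (∀ q c → p q ≡ pQ → p c ≡ pC → Adj G q c) →
    (∀ q i → p q ≡ pQ → p i ≡ pI → ¬ Adj G q i) →
    (∀ c → p c ≡ pC → ∃[ i ] (p i ≡ pI × Adj G c i)) →
    (∀ i → p i ≡ pI → ∃[ c ] (p c ≡ pC × ¬ Adj G i c)) →
    IsSplit G ×
    ((λ v → p v ≡ pC) ≐ AlwaysClique G) ×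
    ((λ v → p v ≡ pI) ≐ AlwaysIndependent G) ×
    ((λ v → p v ≡ pQ) ≐ Questioning G)
lemma7p9 G p clique-C independent-I Q-subsingleton Q-complete-to-C
         Q-anticomplete-to-I C-has-I-neighbour I-has-C-nonneighbour =
    (_ , Q-in-clique-split)
  , (λ v → mk⇔ (C-alwaysClique v) (alwaysClique-C v))
  , (λ v → mk⇔ (I-alwaysIndependent v) (alwaysIndependent-I v))
  , (λ v → mk⇔ (Q-questioning v) (questioning-Q v))
  where
  open ThreePartition G p clique-C independent-I Q-subsingleton Q-complete-to-C
         Q-anticomplete-to-I C-has-I-neighbour I-has-C-nonneighbour
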